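{- Let $p > 3$ be a prime with $|\mathcal{L}_{\lambda}(p)| = p-1$ and let $q$ be a prime with $3 < q < p$. For $1 \leq r \leq q-1$ let $$\mathcal{A}_{q,r} := \left\{(m,j) \in \{1,\ldots,p-1\} \times \{0,\ldots,q-1\} : \frac{pq}{r+1} < m + jp < \frac{pq}{r}\right\}, \quad \mathcal{A}_{q,q} := \{(m,0) : 1 \leq m < p\},$$ and for $(m,j) \in \mathcal{A}_{q,r}$, $1 \leq r \leq q-1$, define $$\psi_r(m,j) := \left( \left\lceil \frac{rm}{p} \right\rceil p - rm,\ q - jr - \left\lceil \frac{rm}{p}\right\rceil \right).$$ Let $(m,j) \in \mathcal{A}_{q,r}$ for some $1 \leq r \leq q-1$ and set $(m',j') := \psi_r(m,j)$. Then: (a) $m' + j'p \equiv 0 \pmod{q}$ whenever $m + jp \equiv 0 \pmod{q}$; (b) $m' = \{ -rm/p\}\,p = p(1 - \{rm/p\})$; (c) $(m',j') \in \bigcup_{r+1 \leq s \leq q} \mathcal{A}_{q,s}$; (d) if $m + jp \equiv 0 \pmod{q}$ then $\lambda(m+jp) = \lambda(r)\lambda(p-1)\lambda(m'+j'p)$, and equivalently $$\lambda(m)\lambda(m+jp) = \left[\lambda(rm)\,\lambda\!\left(p\left\{\frac{rm}{p}\right\}\right)\right] \lambda(m')\lambda(m'+j'p).$$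
   Context: $\lambda$ is the Liouville function, $\lambda(n)=(-1)^{\Omega(n)}$ with $\Omega(n)$ the number of prime factors of $n$ counted with multiplicity. For an integer $N \geq 1$, $\mathcal{L}_{\lambda}(N) := \sum_{1 \leq n < N} \lambda(n)\lambda(N-n)$. For $t \in \mathbb{R}$, $\lceil t \rceil$ is the least integer $\geq t$ and $\{t\} = t - \lfloor t \rfloor$ is the fractional part. -}

module Defs where

open import Data.Nat using (ℕ; zero; suc; _+_; _*_; _∸_; _/_; _%_; _≤_; _<_)
open import Data.Nat.Primality.Factorisation using (factorise; factors)
open import Data.List using (length)
open import Data.Integer using (ℤ; 0ℤ; 1ℤ; -1ℤ) renaming (_+_ to _+ℤ_; _*_ to _*ℤ_)
open import Data.Product using (_×_)
open import Relation.Binary.PropositionalEquality using (_≡_)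

-- Ω(n): number of prime factors of n counted with multiplicity
-- (length of the stdlib prime factorisation of n); Ω(0) := 0 (never used).
Ω : ℕ → ℕ
Ω zero = zero
Ω (suc n) = length (factors (factorise (suc n)))

negOnePow : ℕ → ℤ
negOnePow zero = 1ℤ
negOnePow (suc k) = -1ℤ *ℤ negOnePow k

liouville : ℕ → ℤ
liouville n = negOnePow (Ω n)

sumFrom1Below : (ℕ → ℤ) → ℕ → ℤ
sumFrom1Below f zero = 0ℤ
sumFrom1Below f (suc zero) = 0ℤ
sumFrom1Below f (suc (suc k)) = sumFrom1Below f (suc k) +ℤ f (suc k)

Lλ : ℕ → ℤ
Lλ N = sumFrom1Below (λ n → liouville n *ℤ liouville (N ∸ n)) N

ceilDiv : ℕ → ℕ → ℕ
ceilDiv x zero = zero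
ceilDiv x (suc k) = (x + k) / suc k

-- {x/p} · p  (= x mod p) for p ≥ 1
fracTimes : ℕ → ℕ → ℕ
fracTimes x zero = zero
fracTimes x (suc k) = x % suc k

-- {-x/p} · p  (= (-x) mod p) for p ≥ 1
negFracTimes : ℕ → ℕ → ℕ
negFracTimes x zero = zero
negFracTimes x (suc k) = (suc k ∸ x % suc k) % suc k

-- (m, j) ∈ 𝓐_{q,r}  for 1 ≤ r ≤ q-1 :
-- 1 ≤ m ≤ p-1, 0 ≤ j ≤ q-1, pq/(r+1) < m + jp < pq/r
-- (strict inequalities multiplied through by the positive r+1, r)
InA : (p q r m j : ℕ) → Set
InA p q r m j =
  1 ≤ m × m ≤ p ∸ 1 × j ≤ q ∸ 1 ×
  p * q < (r + 1) * (m + j * p) × r * (m + j * p) < p * q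

InAtop : (p m j : ℕ) → Set
InAtop p m j = 1 ≤ m × m < p × j ≡ 0

ψ₁ : (p r m : ℕ) → ℕ
ψ₁ p r m = ceilDiv (r * m) p * p ∸ r * m

ψ₂ : (p q r m j : ℕ) → ℕ
ψ₂ p q r m j = q ∸ j * r ∸ ceilDiv (r * m) p

module Submission where

-- If |𝓛_λ(p)| = p - 1, all p - 1 terms λ(i) λ(p - i) of the sum are equal,
-- hence equal to λ(p - 1).  Put n = m + j p and n′ = m′ + j′ p.  Since p is
-- prime, r m is not a multiple of p, so m′ = p - (r m mod p) lies in [1, p),
-- and ψ_r is built exactly so that n′ + r n = p q.  Thus q ∣ n gives q ∣ n′,
-- and writing n = k q, n′ = t q we get t + r k = p, whence
-- λ(n) λ(n′) = λ(k) λ(t) = λ(r) λ(r k) λ(p - r k) = λ(r) λ(p - 1).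
-- The same identity and p q < (r + 1) n give (r + 1) n′ < p q, so (m′, j′)
-- lies in 𝓐_{q,s} for s = ⌊p q / n′⌋ > r when j′ ≥ 1.

open import Defs
open import Data.Nat using (ℕ; zero; suc; _+_; _*_; _∸_; _≤_; _<_; z≤n; s≤s; s≤s⁻¹; NonZero; >-nonZero)
open import Data.Nat.Properties
open import Data.Nat.DivMod
open import Data.Nat.Divisibility using (_∣_; divides; ∣m+n∣m⇒∣n; n∣m*n; ∣n⇒∣m*n; ∣⇒≤; m%n≡0⇒n∣m; n∣m⇒m%n≡0)
open import Data.Nat.Primality using (Prime; euclidsLemma; prime⇒nonZero)
open import Data.Nat.Primality.Factorisation
open import Data.Nat.ListAction.Properties using (product-++)
open import Data.Nat.Tactic.RingSolver using (solve)
open import Data.Integer using (ℤ; +_; -[1+_]; 1ℤ; -1ℤ; -≤+; ∣_∣; +≤+; drop‿+≤+) renaming (_*_ to _*ℤ_; _+_ to _+ℤ_; _≤_ to _≤ℤ_; -_ to -ℤ_)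
import Data.Integer.Properties as ℤ
import Data.Integer.Tactic.RingSolver as ℤ-Solver
open import Algebra.Properties.AbelianGroup ℤ.+-0-abelianGroup using (∙-cancelʳ)
open import Data.List using (_∷_; []; _++_)
open import Data.List.Properties using (length-++)
open import Data.List.Relation.Unary.All.Properties using (++⁺)
open import Data.List.Relation.Binary.Permutation.Propositional.Properties using (↭-length)
open import Data.Product using (_×_; _,_; Σ)
open import Data.Sum using (_⊎_; inj₁; inj₂)
open import Relation.Nullary using (¬_; contradiction; yes; no)
open import Relation.Binary.PropositionalEquality
open import Function using (case_of_)

Ω-* : ∀ a b → Ω (suc a * suc b) ≡ Ω (suc a) + Ω (suc b)
Ω-* a b = trans (↭-length (factorisationUnique (factorise (suc a * suc b)) concatenated))
                (length-++ (factors fa))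
  where
  open PrimeFactorisation
  fa : PrimeFactorisation (suc a)
  fa = factorise (suc a)
  fb : PrimeFactorisation (suc b)
  fb = factorise (suc b)
  concatenated : PrimeFactorisation (suc a * suc b)
  concatenated = record
    { factors         = factors fa ++ factors fb
    ; isFactorisation = trans (cong₂ _*_ (isFactorisation fa) (isFactorisation fb))
                              (sym (product-++ (factors fa) (factors fb)))
    ; factorsPrime    = ++⁺ (factorsPrime fa) (factorsPrime fb)
    }

negOnePow-+ : ∀ a b → negOnePow (a + b) ≡ negOnePow a *ℤ negOnePow b
negOnePow-+ zero    b = sym (ℤ.*-identityˡ (negOnePow b))
negOnePow-+ (suc a) b = trans (cong (-1ℤ *ℤ_) (negOnePow-+ a b))
                              (sym (ℤ.*-assoc -1ℤ (negOnePow a) (negOnePow b)))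

liouville-* : ∀ {a b} → 1 ≤ a → 1 ≤ b → liouville (a * b) ≡ liouville a *ℤ liouville b
liouville-* {suc a} {suc b} _ _ = trans (cong negOnePow (Ω-* a b)) (negOnePow-+ (Ω (suc a)) (Ω (suc b)))

IsSign : ℤ → Set
IsSign x = x ≡ 1ℤ ⊎ x ≡ -1ℤ

IsSign-* : ∀ {x y} → IsSign x → IsSign y → IsSign (x *ℤ y)
IsSign-* (inj₁ refl) (inj₁ refl) = inj₁ refl
IsSign-* (inj₁ refl) (inj₂ refl) = inj₂ refl
IsSign-* (inj₂ refl) (inj₁ refl) = inj₂ refl
IsSign-* (inj₂ refl) (inj₂ refl) = inj₁ refl

IsSign⇒x*x≡1 : ∀ {x} → IsSign x → x *ℤ x ≡ 1ℤ
IsSign⇒x*x≡1 (inj₁ refl) = refl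
IsSign⇒x*x≡1 (inj₂ refl) = refl

negOnePow-isSign : ∀ k → IsSign (negOnePow k)
negOnePow-isSign zero    = inj₁ refl
negOnePow-isSign (suc k) = IsSign-* (inj₂ refl) (negOnePow-isSign k)

liouville-isSign : ∀ n → IsSign (liouville n)
liouville-isSign n = negOnePow-isSign (Ω n)

sumFrom1Below≤n : ∀ {g} → (∀ i → IsSign (g i)) → ∀ n → sumFrom1Below g (suc n) ≤ℤ + n
sumFrom1Below≤n g±1 zero    = +≤+ z≤n
sumFrom1Below≤n {g} g±1 (suc n) = subst (sumFrom1Below g (suc n) +ℤ g (suc n) ≤ℤ_) n+1≡1+n
  (ℤ.+-mono-≤ (sumFrom1Below≤n g±1 n) (g≤1 (g±1 (suc n))))
  where
  n+1≡1+n : + n +ℤ 1ℤ ≡ + suc n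
  n+1≡1+n = sym (trans (cong +_ (+-comm 1 n)) (ℤ.pos-+ n 1))
  g≤1 : ∀ {x} → IsSign x → x ≤ℤ 1ℤ
  g≤1 (inj₁ refl) = ℤ.≤-refl
  g≤1 (inj₂ refl) = -≤+

sumFrom1Below-peel : ∀ {g} → (∀ i → IsSign (g i)) → ∀ n →
  sumFrom1Below g (2 + n) ≡ + suc n → g (suc n) ≡ 1ℤ × sumFrom1Below g (suc n) ≡ + n
sumFrom1Below-peel {g} g±1 n sum≡1+n with g±1 (suc n)
... | inj₁ g≡1  = g≡1 , ∙-cancelʳ 1ℤ _ _ (begin
      sumFrom1Below g (suc n) +ℤ 1ℤ         ≡⟨ cong (sumFrom1Below g (suc n) +ℤ_) g≡1 ⟨
      sumFrom1Below g (suc n) +ℤ g (suc n)  ≡⟨ sum≡1+n ⟩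
      + suc n                               ≡⟨ cong +_ (+-comm 1 n) ⟩
      + (n + 1)                             ≡⟨ ℤ.pos-+ n 1 ⟩
      + n +ℤ 1ℤ                             ∎)
  where open ≡-Reasoning
... | inj₂ g≡-1 = contradiction (drop‿+≤+ (subst (_≤ℤ + n) sum≡2+n (sumFrom1Below≤n g±1 n))) (<⇒≱ (s≤s (n≤1+n n)))
  where
  sum≡2+n : sumFrom1Below g (suc n) ≡ + suc (suc n)
  sum≡2+n = ∙-cancelʳ -1ℤ _ _ (trans (cong (sumFrom1Below g (suc n) +ℤ_) (sym g≡-1)) sum≡1+n)

sumFrom1Below≡n⇒≡1 : ∀ {g} → (∀ i → IsSign (g i)) → ∀ n →
  sumFrom1Below g (suc n) ≡ + n → ∀ {i} → 1 ≤ i → i ≤ n → g i ≡ 1ℤ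
sumFrom1Below≡n⇒≡1 g±1 zero    _       1≤i i≤0 = contradiction (≤-trans 1≤i i≤0) λ ()
sumFrom1Below≡n⇒≡1 g±1 (suc n) sum≡1+n 1≤i i≤1+n
  with sumFrom1Below-peel g±1 n sum≡1+n | m≤n⇒m<n∨m≡n i≤1+n
... | g≡1 , _      | inj₂ refl  = g≡1
... | _   , sum≡n  | inj₁ i<1+n = sumFrom1Below≡n⇒≡1 g±1 n sum≡n 1≤i (s≤s⁻¹ i<1+n)

sumFrom1Below-neg : ∀ g n → sumFrom1Below (λ i → -ℤ g i) n ≡ -ℤ sumFrom1Below g n
sumFrom1Below-neg g zero          = refl
sumFrom1Below-neg g (suc zero)    = refl
sumFrom1Below-neg g (suc (suc n)) =
  trans (cong (_+ℤ -ℤ g (suc n)) (sumFrom1Below-neg g (suc n)))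
        (sym (ℤ.neg-distrib-+ (sumFrom1Below g (suc n)) (g (suc n))))

∣sumFrom1Below∣≡n⇒constant : ∀ {g} → (∀ i → IsSign (g i)) → ∀ n →
  ∣ sumFrom1Below g (suc n) ∣ ≡ n → ∀ {i} → 1 ≤ i → i ≤ n → g i ≡ g 1
∣sumFrom1Below∣≡n⇒constant {g} g±1 n ∣sum∣≡n {i} 1≤i i≤n
  with sumFrom1Below g (suc n) in sum≡ | ∣sum∣≡n
... | + _       | refl = trans (all≡1 1≤i i≤n) (sym (all≡1 ≤-refl (≤-trans 1≤i i≤n)))
  where
  all≡1 : ∀ {i} → 1 ≤ i → i ≤ n → g i ≡ 1ℤ
  all≡1 = sumFrom1Below≡n⇒≡1 g±1 n sum≡
... | -[1+ k ]   | refl = trans (all≡-1 1≤i i≤n) (sym (all≡-1 ≤-refl (≤-trans 1≤i i≤n)))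
  where
  -g±1 : ∀ i → IsSign (-ℤ g i)
  -g±1 i with g±1 i
  ... | inj₁ g≡1  = inj₂ (cong -ℤ_ g≡1)
  ... | inj₂ g≡-1 = inj₁ (cong -ℤ_ g≡-1)
  all≡-1 : ∀ {i} → 1 ≤ i → i ≤ suc k → g i ≡ -1ℤ
  all≡-1 {i} 1≤i i≤n = trans (sym (ℤ.neg-involutive (g i))) (cong -ℤ_
    (sumFrom1Below≡n⇒≡1 -g±1 (suc k) (trans (sumFrom1Below-neg g (suc (suc k))) (cong -ℤ_ sum≡)) 1≤i i≤n))

LiouvillePairsConstant : ℕ → Set
LiouvillePairsConstant p =
  ∀ {i} → 1 ≤ i → i ≤ p ∸ 1 → liouville i *ℤ liouville (p ∸ i) ≡ liouville (p ∸ 1)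

∣Lλ∣≡p∸1⇒pairsConstant : ∀ p → ∣ Lλ p ∣ ≡ p ∸ 1 → LiouvillePairsConstant p
∣Lλ∣≡p∸1⇒pairsConstant zero    _      1≤i i≤0 = contradiction (≤-trans 1≤i i≤0) λ ()
∣Lλ∣≡p∸1⇒pairsConstant (suc n) ∣L∣≡n 1≤i i≤n =
  trans (∣sumFrom1Below∣≡n⇒constant pairs±1 n ∣L∣≡n 1≤i i≤n) (ℤ.*-identityˡ (liouville n))
  where
  pairs±1 : ∀ i → IsSign (liouville i *ℤ liouville (suc n ∸ i))
  pairs±1 i = IsSign-* (liouville-isSign i) (liouville-isSign (suc n ∸ i))

fracTimes≡% : ∀ x p .{{_ : NonZero p}} → fracTimes x p ≡ x % p
fracTimes≡% x (suc _) = refl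

negFracTimes≡[p∸%]% : ∀ x p .{{_ : NonZero p}} → negFracTimes x p ≡ (p ∸ x % p) % p
negFracTimes≡[p∸%]% x (suc _) = refl

ceilDiv-nonmultiple : ∀ {p} .{{_ : NonZero p}} {R} Q → 0 < R → R < p →
  ceilDiv (R + Q * p) p ≡ suc Q
ceilDiv-nonmultiple {suc k} {suc R} Q _ 1+R<p = begin
  (suc R + Q * suc k + k) / suc k        ≡⟨ cong (_/ suc k) shift ⟩
  (R + suc Q * suc k) / suc k            ≡⟨ +-distrib-/-∣ʳ R (n∣m*n (suc Q)) ⟩
  R / suc k + suc Q * suc k / suc k      ≡⟨ cong₂ _+_ (m<n⇒m/n≡0 (<⇒≤ 1+R<p)) (m*n/n≡m (suc Q) (suc k)) ⟩
  suc Q                                  ∎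
  where
  open ≡-Reasoning
  shift : suc R + Q * suc k + k ≡ R + suc Q * suc k
  shift = solve (R ∷ Q ∷ k ∷ [])

0<[m*n]%p : ∀ {p m n} .{{_ : NonZero p}} → Prime p → 1 ≤ m → m < p → 1 ≤ n → n < p →
  0 < (m * n) % p
0<[m*n]%p {p} {m} {n} p-prime 1≤m m<p 1≤n n<p = n≢0⇒n>0 λ [mn]%p≡0 →
  case euclidsLemma m n p-prime (m%n≡0⇒n∣m (m * n) p [mn]%p≡0) of λ where
    (inj₁ p∣m) → <⇒≱ m<p (∣⇒≤ {{>-nonZero 1≤m}} p∣m)
    (inj₂ p∣n) → <⇒≱ n<p (∣⇒≤ {{>-nonZero 1≤n}} p∣n)

n∤m+k*n : ∀ {m n} k .{{_ : NonZero n}} → 0 < m → m < n → ¬ n ∣ m + k * n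
n∤m+k*n {m} {n} k 0<m m<n n∣m+kn = <⇒≢ 0<m (begin
  0                ≡⟨ n∣m⇒m%n≡0 (m + k * n) n n∣m+kn ⟨
  (m + k * n) % n  ≡⟨ [m+kn]%n≡m%n m k n ⟩
  m % n            ≡⟨ m<n⇒m%n≡m m<n ⟩
  m                ∎)
  where open ≡-Reasoning

m<[1+m/n]*n : ∀ m n .{{_ : NonZero n}} → m < suc (m / n) * n
m<[1+m/n]*n m n = begin-strict
  m                  ≡⟨ m≡m%n+[m/n]*n m n ⟩
  m % n + m / n * n  <⟨ +-monoˡ-< (m / n * n) (m%n<n m n) ⟩
  n + m / n * n      ∎
  where open ≤-Reasoning

k*n≤m⇒k≤m/n : ∀ k m n .{{_ : NonZero n}} → k * n ≤ m → k ≤ m / n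
k*n≤m⇒k≤m/n k m n kn≤m = subst (_≤ m / n) (m*n/n≡m k n) (/-monoˡ-≤ n kn≤m)

-- If p ∤ n then k * n = p * q forces p ∣ k, whence n ∣ q.
k*n≢p*q : ∀ {p q k n} → Prime p → ¬ p ∣ n → 0 < q → q < n → k * n ≢ p * q
k*n≢p*q {p} {q} {k} {n} p-prime p∤n 0<q q<n kn≡pq
  with euclidsLemma k n p-prime (divides q (trans kn≡pq (*-comm p q)))
... | inj₂ p∣n             = p∤n p∣n
... | inj₁ (divides t k≡tp) = <⇒≱ q<n (∣⇒≤ {{>-nonZero 0<q}} (divides t q≡tn))
  where
  instance
    p≢0 : NonZero p
    p≢0 = prime⇒nonZero p-prime
  q≡tn : q ≡ t * n
  q≡tn = *-cancelˡ-≡ q (t * n) p (begin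
    p * q        ≡⟨ kn≡pq ⟨
    k * n        ≡⟨ cong (_* n) k≡tp ⟩
    t * p * n    ≡⟨ solve (t ∷ p ∷ n ∷ []) ⟩
    p * (t * n)  ∎)
    where open ≡-Reasoning

1≤m*n⇒1≤m : ∀ m {n} → 1 ≤ m * n → 1 ≤ m
1≤m*n⇒1≤m (suc _) _ = s≤s z≤n

liouville-complement : ∀ {p q r x y} → LiouvillePairsConstant p →
  1 ≤ q → 1 ≤ r → 1 ≤ x → 1 ≤ y → q ∣ x → q ∣ y → y + r * x ≡ p * q →
  liouville x ≡ liouville r *ℤ liouville (p ∸ 1) *ℤ liouville y
liouville-complement {p} {q} {r} {x} {y} pairs 1≤q 1≤r 1≤x 1≤y
  (divides k x≡kq) (divides t y≡tq) y+rx≡pq = begin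
  liouville x                                 ≡⟨ cong liouville x≡kq ⟩
  liouville (k * q)                           ≡⟨ liouville-* 1≤k 1≤q ⟩
  liouville k *ℤ liouville q                  ≡⟨ insert-squares (liouville-isSign r) (liouville-isSign t) ⟩
  liouville r *ℤ ((liouville r *ℤ liouville k) *ℤ liouville t) *ℤ (liouville t *ℤ liouville q)
                                              ≡⟨ cong₂ (λ a b → liouville r *ℤ a *ℤ b) pair (sym (liouville-* 1≤t 1≤q)) ⟩
  liouville r *ℤ liouville (p ∸ 1) *ℤ liouville (t * q)
                                              ≡⟨ cong (λ z → liouville r *ℤ liouville (p ∸ 1) *ℤ liouville z) y≡tq ⟨
  liouville r *ℤ liouville (p ∸ 1) *ℤ liouville y  ∎
  where
  open ≡-Reasoning
  insert-squares : ∀ {a b c d} → IsSign a → IsSign c → b *ℤ d ≡ a *ℤ ((a *ℤ b) *ℤ c) *ℤ (c *ℤ d)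
  insert-squares {a} {b} {c} {d} a±1 c±1 = begin
    b *ℤ d                            ≡⟨ ℤ.*-identityˡ (b *ℤ d) ⟨
    1ℤ *ℤ 1ℤ *ℤ (b *ℤ d)              ≡⟨ cong₂ (λ u v → u *ℤ v *ℤ (b *ℤ d)) (IsSign⇒x*x≡1 a±1) (IsSign⇒x*x≡1 c±1) ⟨
    (a *ℤ a) *ℤ (c *ℤ c) *ℤ (b *ℤ d)  ≡⟨ ℤ-Solver.solve (a ∷ b ∷ c ∷ d ∷ []) ⟩
    a *ℤ ((a *ℤ b) *ℤ c) *ℤ (c *ℤ d)  ∎
  1≤k : 1 ≤ k
  1≤k = 1≤m*n⇒1≤m k (subst (1 ≤_) x≡kq 1≤x)
  1≤t : 1 ≤ t
  1≤t = 1≤m*n⇒1≤m t (subst (1 ≤_) y≡tq 1≤y)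
  t+rk≡p : t + r * k ≡ p
  t+rk≡p = *-cancelʳ-≡ (t + r * k) p q {{>-nonZero 1≤q}} (begin
    (t + r * k) * q      ≡⟨ solve (t ∷ r ∷ k ∷ q ∷ []) ⟩
    t * q + r * (k * q)  ≡⟨ cong₂ (λ u v → u + r * v) y≡tq x≡kq ⟨
    y + r * x            ≡⟨ y+rx≡pq ⟩
    p * q                ∎)
  rk≤p∸1 : r * k ≤ p ∸ 1
  rk≤p∸1 = <⇒≤pred (subst (r * k <_) t+rk≡p (m<n+m (r * k) 1≤t))
  pair : (liouville r *ℤ liouville k) *ℤ liouville t ≡ liouville (p ∸ 1)
  pair = begin
    (liouville r *ℤ liouville k) *ℤ liouville t
      ≡⟨ cong₂ _*ℤ_ (liouville-* 1≤r 1≤k) (cong liouville (m+n∸n≡m t (r * k))) ⟨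
    liouville (r * k) *ℤ liouville (t + r * k ∸ r * k)
      ≡⟨ cong (λ z → liouville (r * k) *ℤ liouville (z ∸ r * k)) t+rk≡p ⟩
    liouville (r * k) *ℤ liouville (p ∸ r * k)
      ≡⟨ pairs (*-mono-≤ 1≤r 1≤k) rk≤p∸1 ⟩
    liouville (p ∸ 1)  ∎

ψ-identity : ∀ {p q r m j m′ j′ c} → m′ + r * m ≡ c * p → j′ + c + j * r ≡ q →
  m′ + j′ * p + r * (m + j * p) ≡ p * q
ψ-identity {p} {q} {r} {m} {j} {m′} {j′} {c} m′+rm≡cp j′+c+jr≡q = begin
  m′ + j′ * p + r * (m + j * p)    ≡⟨ solve (m′ ∷ j′ ∷ p ∷ r ∷ m ∷ j ∷ []) ⟩
  (m′ + r * m) + (j′ + j * r) * p  ≡⟨ cong (_+ (j′ + j * r) * p) m′+rm≡cp ⟩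
  c * p + (j′ + j * r) * p         ≡⟨ solve (c ∷ p ∷ j′ ∷ j ∷ r ∷ []) ⟩
  (j′ + c + j * r) * p             ≡⟨ cong (_* p) j′+c+jr≡q ⟩
  q * p                            ≡⟨ *-comm q p ⟩
  p * q                            ∎
  where open ≡-Reasoning

module ψ-Properties (p q r m j : ℕ) (p-prime : Prime p) (q<p : q < p)
  (1≤r : 1 ≤ r) (r≤q∸1 : r ≤ q ∸ 1) (1≤m : 1 ≤ m) (m≤p∸1 : m ≤ p ∸ 1)
  (pq<[r+1]n : p * q < (r + 1) * (m + j * p)) (rn<pq : r * (m + j * p) < p * q)
  where

  instance
    p≢0 : NonZero p
    p≢0 = prime⇒nonZero p-prime

  n m′ j′ n′ c : ℕ
  n  = m + j * p
  m′ = ψ₁ p r m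
  j′ = ψ₂ p q r m j
  n′ = m′ + j′ * p
  c  = ceilDiv (r * m) p

  0<q : 0 < q
  0<q = ≤-trans 1≤r (≤-trans r≤q∸1 (m∸n≤m q 1))

  m<p : m < p
  m<p = m≤pred[n]⇒suc[m]≤n m≤p∸1

  r<p : r < p
  r<p = ≤-<-trans (≤-trans r≤q∸1 (m∸n≤m q 1)) q<p

  0<[rm]%p : 0 < r * m % p
  0<[rm]%p = 0<[m*n]%p p-prime 1≤r r<p 1≤m m<p

  c≡1+[rm]/p : c ≡ suc (r * m / p)
  c≡1+[rm]/p = subst (λ x → ceilDiv x p ≡ suc (r * m / p)) (sym (m≡m%n+[m/n]*n (r * m) p))
    (ceilDiv-nonmultiple (r * m / p) 0<[rm]%p (m%n<n (r * m) p))

  m′≡p∸[rm]%p : m′ ≡ p ∸ r * m % p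
  m′≡p∸[rm]%p = begin
    c * p ∸ r * m                                     ≡⟨ cong₂ (λ c′ x → c′ * p ∸ x) c≡1+[rm]/p (m≡m%n+[m/n]*n (r * m) p) ⟩
    (p + r * m / p * p) ∸ (r * m % p + r * m / p * p) ≡⟨ cong₂ _∸_ (+-comm p _) (+-comm (r * m % p) _) ⟩
    (r * m / p * p + p) ∸ (r * m / p * p + r * m % p) ≡⟨ [m+n]∸[m+o]≡n∸o (r * m / p * p) p (r * m % p) ⟩
    p ∸ r * m % p                                     ∎
    where open ≡-Reasoning

  1≤m′ : 1 ≤ m′
  1≤m′ = subst (1 ≤_) (sym m′≡p∸[rm]%p) (m<n⇒0<n∸m (m%n<n (r * m) p))

  1≤n′ : 1 ≤ n′
  1≤n′ = ≤-trans 1≤m′ (m≤m+n m′ (j′ * p))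

  1≤n : 1 ≤ n
  1≤n = ≤-trans 1≤m (m≤m+n m (j * p))

  m′<p : m′ < p
  m′<p = subst (_< p) (sym m′≡p∸[rm]%p) (∸-monoʳ-< 0<[rm]%p (<⇒≤ (m%n<n (r * m) p)))

  m′+rm≡cp : m′ + r * m ≡ c * p
  m′+rm≡cp = m∸n+n≡m (begin
    r * m                          ≡⟨ m≡m%n+[m/n]*n (r * m) p ⟩
    r * m % p + r * m / p * p      ≤⟨ +-monoˡ-≤ (r * m / p * p) (<⇒≤ (m%n<n (r * m) p)) ⟩
    suc (r * m / p) * p            ≡⟨ cong (_* p) c≡1+[rm]/p ⟨
    c * p                          ∎)
    where open ≤-Reasoning

  rn≡rm+jr*p : r * (m + j * p) ≡ r * m + j * r * p
  rn≡rm+jr*p = solve (r ∷ m ∷ j ∷ p ∷ [])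

  c+jr≤q : c + j * r ≤ q
  c+jr≤q = subst (_≤ q) (cong (_+ j * r) (sym c≡1+[rm]/p)) (begin-strict
    r * m / p + j * r              ≡⟨ cong (_+_ (r * m / p)) (m*n/n≡m (j * r) p) ⟨
    r * m / p + j * r * p / p      ≡⟨ +-distrib-/-∣ʳ (r * m) (n∣m*n (j * r)) ⟨
    (r * m + j * r * p) / p        ≡⟨ cong (_/ p) rn≡rm+jr*p ⟨
    r * (m + j * p) / p            <⟨ m<n*o⇒m/o<n (subst (r * n <_) (*-comm p q) rn<pq) ⟩
    q                              ∎)
    where open ≤-Reasoning

  j′+c+jr≡q : j′ + c + j * r ≡ q
  j′+c+jr≡q = begin
    q ∸ j * r ∸ c + c + j * r  ≡⟨ cong (_+ j * r) (m∸n+n≡m (m+n≤o⇒m≤o∸n c c+jr≤q)) ⟩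
    q ∸ j * r + j * r          ≡⟨ m∸n+n≡m (≤-trans (m≤n+m (j * r) c) c+jr≤q) ⟩
    q                          ∎
    where open ≡-Reasoning

  j′≤q∸1 : j′ ≤ q ∸ 1
  j′≤q∸1 = ≤-trans (∸-monoˡ-≤ c (m∸n≤m q (j * r))) (∸-monoʳ-≤ q (subst (1 ≤_) (sym c≡1+[rm]/p) (s≤s z≤n)))

  n′+rn≡pq : n′ + r * n ≡ p * q
  n′+rn≡pq = ψ-identity {p} {q} {r} {m} {j} {m′} {j′} {c} m′+rm≡cp j′+c+jr≡q

  q∣n⇒q∣n′ : q ∣ n → q ∣ n′
  q∣n⇒q∣n′ q∣n = ∣m+n∣m⇒∣n (subst (q ∣_) (trans (sym n′+rn≡pq) (+-comm n′ (r * n))) (n∣m*n p))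
                           (∣n⇒∣m*n r q∣n)

  m′≡negFracTimes : m′ ≡ negFracTimes (r * m) p
  m′≡negFracTimes = begin
    m′                     ≡⟨ m<n⇒m%n≡m m′<p ⟨
    m′ % p                 ≡⟨ cong (_% p) m′≡p∸[rm]%p ⟩
    (p ∸ r * m % p) % p    ≡⟨ negFracTimes≡[p∸%]% (r * m) p ⟨
    negFracTimes (r * m) p ∎
    where open ≡-Reasoning

  m′≡p∸fracTimes : m′ ≡ p ∸ fracTimes (r * m) p
  m′≡p∸fracTimes = trans m′≡p∸[rm]%p (cong (p ∸_) (sym (fracTimes≡% (r * m) p)))

  [r+1]n′<pq : (r + 1) * n′ < p * q
  [r+1]n′<pq = +-cancelʳ-< (r * (p * q)) ((r + 1) * n′) (p * q) (begin-strict
    (r + 1) * n′ + r * (p * q)        <⟨ +-monoʳ-< ((r + 1) * n′) (*-monoʳ-< r {{>-nonZero 1≤r}} pq<[r+1]n) ⟩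
    (r + 1) * n′ + r * ((r + 1) * n)  ≡⟨ distrib n′ n ⟩
    (r + 1) * (n′ + r * n)            ≡⟨ cong ((r + 1) *_) n′+rn≡pq ⟩
    (r + 1) * (p * q)                 ≡⟨ split (p * q) ⟩
    p * q + r * (p * q)               ∎)
    where
    open ≤-Reasoning
    distrib : ∀ a b → (r + 1) * a + r * ((r + 1) * b) ≡ (r + 1) * (a + r * b)
    distrib a b = solve (r ∷ a ∷ b ∷ [])
    split : ∀ a → (r + 1) * a ≡ a + r * a
    split a = solve (r ∷ a ∷ [])

  -- The division p q / n′ is inexact because p ∤ n′ while p ∣ p q.
  ψ-∈A : 1 ≤ j′ → Σ ℕ (λ s → r + 1 ≤ s × s ≤ q ∸ 1 × InA p q s m′ j′)
  ψ-∈A 1≤j′ = s , r+1≤s , <⇒≤pred s<q , 1≤m′ , <⇒≤pred m′<p , j′≤q∸1 , pq<[s+1]n′ , sn′<pq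
    where
    p<n′ : p < n′
    p<n′ = <-≤-trans (m<n+m p 1≤m′) (+-monoʳ-≤ m′ (m≤n*m p j′ {{>-nonZero 1≤j′}}))
    instance
      n′≢0 : NonZero n′
      n′≢0 = >-nonZero 1≤n′
    s : ℕ
    s = p * q / n′
    r+1≤s : r + 1 ≤ s
    r+1≤s = k*n≤m⇒k≤m/n (r + 1) (p * q) n′ (<⇒≤ [r+1]n′<pq)
    s<q : s < q
    s<q = m<n*o⇒m/o<n (subst (_< q * n′) (*-comm q p) (*-monoʳ-< q {{>-nonZero 0<q}} p<n′))
    pq<[s+1]n′ : p * q < (s + 1) * n′
    pq<[s+1]n′ = subst (λ k → p * q < k * n′) (+-comm 1 s) (m<[1+m/n]*n (p * q) n′)
    sn′<pq : s * n′ < p * q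
    sn′<pq = ≤∧≢⇒< (m/n*n≤m (p * q) n′)
      (k*n≢p*q {k = s} p-prime (n∤m+k*n j′ 1≤m′ m′<p) 0<q (<-trans q<p p<n′))

  ψ-∈⋃A : Σ ℕ (λ s → r + 1 ≤ s × s ≤ q ∸ 1 × InA p q s m′ j′) ⊎ InAtop p m′ j′
  ψ-∈⋃A with j′ ≟ 0
  ... | yes j′≡0 = inj₂ (1≤m′ , m′<p , j′≡0)
  ... | no  j′≢0 = inj₁ (ψ-∈A (n≢0⇒n>0 j′≢0))

  liouville-n : LiouvillePairsConstant p → q ∣ n →
    liouville n ≡ liouville r *ℤ liouville (p ∸ 1) *ℤ liouville n′
  liouville-n pairs q∣n =
    liouville-complement pairs 0<q 1≤r 1≤n 1≤n′ q∣n (q∣n⇒q∣n′ q∣n) n′+rn≡pq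

  liouville-m*n : LiouvillePairsConstant p → q ∣ n →
    liouville m *ℤ liouville n
      ≡ (liouville (r * m) *ℤ liouville (fracTimes (r * m) p)) *ℤ liouville m′ *ℤ liouville n′
  liouville-m*n pairs q∣n = begin
    liouville m *ℤ liouville n
      ≡⟨ cong (liouville m *ℤ_) (liouville-n pairs q∣n) ⟩
    liouville m *ℤ (liouville r *ℤ liouville (p ∸ 1) *ℤ liouville n′)
      ≡⟨ cong (λ z → liouville m *ℤ (liouville r *ℤ z *ℤ liouville n′)) (pairs 0<[rm]%p (<⇒≤pred (m%n<n (r * m) p))) ⟨
    liouville m *ℤ (liouville r *ℤ (liouville (r * m % p) *ℤ liouville (p ∸ r * m % p)) *ℤ liouville n′)
      ≡⟨ regroup (liouville r) (liouville m) (liouville (r * m % p)) (liouville (p ∸ r * m % p)) (liouville n′) ⟩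
    ((liouville r *ℤ liouville m) *ℤ liouville (r * m % p)) *ℤ liouville (p ∸ r * m % p) *ℤ liouville n′
      ≡⟨ cong₂ (λ a b → (a *ℤ liouville (r * m % p)) *ℤ b *ℤ liouville n′)
               (liouville-* 1≤r 1≤m) (cong liouville m′≡p∸[rm]%p) ⟨
    (liouville (r * m) *ℤ liouville (r * m % p)) *ℤ liouville m′ *ℤ liouville n′
      ≡⟨ cong (λ z → (liouville (r * m) *ℤ liouville z) *ℤ liouville m′ *ℤ liouville n′) (fracTimes≡% (r * m) p) ⟨
    (liouville (r * m) *ℤ liouville (fracTimes (r * m) p)) *ℤ liouville m′ *ℤ liouville n′
      ∎
    where
    open ≡-Reasoning
    regroup : ∀ a b c d y → b *ℤ (a *ℤ (c *ℤ d) *ℤ y) ≡ ((a *ℤ b) *ℤ c) *ℤ d *ℤ y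
    regroup a b c d y = ℤ-Solver.solve (a ∷ b ∷ c ∷ d ∷ y ∷ [])

lemma3p1 : (p q r m j : ℕ) → Prime p → 3 < p → ∣ Lλ p ∣ ≡ p ∸ 1 →
    Prime q → 3 < q → q < p → 1 ≤ r → r ≤ q ∸ 1 → InA p q r m j →
    (q ∣ m + j * p → q ∣ ψ₁ p r m + ψ₂ p q r m j * p)
    × (ψ₁ p r m ≡ negFracTimes (r * m) p × ψ₁ p r m ≡ p ∸ fracTimes (r * m) p)
    × ((Σ ℕ (λ s → r + 1 ≤ s × s ≤ q ∸ 1 × InA p q s (ψ₁ p r m) (ψ₂ p q r m j)))
       ⊎ InAtop p (ψ₁ p r m) (ψ₂ p q r m j))
    × (q ∣ m + j * p →
        (liouville (m + j * p)
          ≡ liouville r *ℤ liouville (p ∸ 1) *ℤ liouville (ψ₁ p r m + ψ₂ p q r m j * p))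
        × (liouville m *ℤ liouville (m + j * p)
          ≡ (liouville (r * m) *ℤ liouville (fracTimes (r * m) p))
            *ℤ liouville (ψ₁ p r m) *ℤ liouville (ψ₁ p r m + ψ₂ p q r m j * p)))
lemma3p1 p q r m j p-prime _ ∣Lλ∣≡p∸1 _ _ q<p 1≤r r≤q∸1 (1≤m , m≤p∸1 , _ , pq<[r+1]n , rn<pq) =
  q∣n⇒q∣n′ , (m′≡negFracTimes , m′≡p∸fracTimes) , ψ-∈⋃A ,
  λ q∣n → liouville-n pairs q∣n , liouville-m*n pairs q∣n
  where
  open ψ-Properties p q r m j p-prime q<p 1≤r r≤q∸1 1≤m m≤p∸1 pq<[r+1]n rn<pq
  pairs : LiouvillePairsConstant p
  pairs = ∣Lλ∣≡p∸1⇒pairsConstant p ∣Lλ∣≡p∸1
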